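{- For every $t<n$ there exists a protocol for $n$ processors solving binary Commit-Adopt against a mobile send-omission $t$-MAd adversary.
   Context: System: $n$ processors run a synchronous round-based protocol; each round every processor sends a (possibly different) message to every processor over dedicated point-to-point channels whose receiver knows the sender identity; messages of round $\rho$ are delivered by the start of round $\rho+1$. A message adversary (MAd) sees all messages; in the send-omission type it may delete any of the outgoing messages, in a given round, of the processors it corrupts in that round; it never alters internal states, inputs, outputs or incoming messages. A mobile $t$-MAd adversary corrupts at most $t$ processors in each round, possibly a different set each round. Every processor (corrupted or not) must output and the task conditions apply to all processors. Binary Commit-Adopt: each processor has an input bit and outputs $commit(v)$ or $adopt(v)$ with $v$ some processor's input; if all inputs equal $v$ all output $commit(v)$; if some processor outputs $commit(v)$ then every processor outputs $commit(v)$ or $adopt(v)$. -}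

module Defs where

open import Data.Nat using (ℕ; zero; suc; _≤_)
open import Data.Bool using (Bool; true; false; if_then_else_)
open import Data.Fin using (Fin)
open import Data.Fin.Subset using (Subset; _∈_; ∣_∣)
open import Data.Maybe using (Maybe; just; nothing)
open import Data.Product using (Σ; ∃; _×_)
open import Data.Sum using (_⊎_)
open import Relation.Binary.PropositionalEquality using (_≡_)

data Decision : Set where
  commit : Bool → Decision
  adopt  : Bool → Decision

value : Decision → Bool
value (commit v) = v
value (adopt v)  = v

-- In round ρ, processor i in state s sends  send ρ i s j  to processor j.
-- Receiver j gets, for each sender i, either  just m  (delivered) or
-- nothing (deleted); the sender identity is the index i.
record Protocol (n : ℕ) : Set₁ where
  field
    State  : Set
    Msg    : Set
    rounds : ℕ
    init   : Fin n → Bool → State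
    send   : ℕ → Fin n → State → Fin n → Msg
    step   : ℕ → Fin n → State → (Fin n → Maybe Msg) → State
    output : Fin n → State → Decision

-- Mobile send-omission t-MAd: in each round ρ it corrupts a set of at
-- most t processors (possibly a different set each round) and may delete
-- any outgoing message (from i to j) of a processor i corrupted in round ρ.
-- (Protocols are deterministic, so an adaptive adversary that sees all
-- messages amounts to choosing such a schedule for each input vector.)
record MobileSendOmissionMAd (n t : ℕ) : Set where
  field
    corrupted : ℕ → Subset n
    bound     : ∀ ρ → ∣ corrupted ρ ∣ ≤ t
    delete    : ℕ → Fin n → Fin n → Bool      -- round, sender, receiver
    deleteOK  : ∀ ρ i j → delete ρ i j ≡ true → i ∈ corrupted ρ

module _ {n t : ℕ} (P : Protocol n) (adv : MobileSendOmissionMAd n t)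
         (inp : Fin n → Bool) where
  open Protocol P
  open MobileSendOmissionMAd adv

  config : ℕ → Fin n → State
  config zero    i = init i (inp i)
  config (suc ρ) j = step ρ j (config ρ j)
    (λ i → if delete ρ i j then nothing else just (send ρ i (config ρ i) j))

  decision : Fin n → Decision
  decision i = output i (config rounds i)

-- P solves binary Commit-Adopt against every mobile send-omission t-MAd,
-- with the conditions applied to all processors (corrupted or not).
SolvesCommitAdopt : {n : ℕ} → Protocol n → ℕ → Set
SolvesCommitAdopt {n} P t =
  (adv : MobileSendOmissionMAd n t) (inp : Fin n → Bool) →
    (∀ i → ∃ λ j → inp j ≡ value (decision P adv inp i))
    × (∀ v → (∀ j → inp j ≡ v) → ∀ i → decision P adv inp i ≡ commit v)
    × (∀ i v → decision P adv inp i ≡ commit v →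
         ∀ j → decision P adv inp j ≡ commit v ⊎ decision P adv inp j ≡ adopt v)

-- Since t < n, in every round some processor is not corrupted, so all of its
-- messages arrive.  In the first round the processors exchange inputs, and a
-- processor proposes its input unless a delivered input differs from it; as the
-- first round's reliable sender reaches everyone, every proposal is its input.
-- In the second round they exchange proposals: a processor commits to its
-- proposal unless a delivered proposal differs from it (or is empty), and
-- otherwise adopts its own or some received proposal, falling back on its input.
-- A commit to w forces the second round's reliable sender to have proposed w,
-- and that proposal reaches everyone, so nobody can end with the other value.
module Submission where

open import Defs
open import Data.Bool using (Bool; true; false; if_then_else_)
open import Data.Fin using (Fin; zero; suc)
open import Data.Fin.Properties using (all?; any?)
open import Data.Vec using (_∷_)
open import Data.Fin.Subset using (Subset; _∉_; ∣_∣; inside; outside)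
open import Data.Fin.Subset.Properties using (drop-there)
open import Data.Maybe using (Maybe; just; nothing)
open import Data.Maybe.Properties using (just-injective; ≡-dec)
open import Data.Maybe.Relation.Unary.All as Maybe using (just; nothing; drop-just)
open import Data.Nat using (ℕ; zero; suc; _<_; s≤s)
open import Data.Nat.Properties using (<-≤-trans)
open import Data.Product using (Σ; ∃; _×_; _,_; proj₁)
open import Data.Sum using (_⊎_; inj₁; inj₂)
open import Relation.Binary.PropositionalEquality using (_≡_; refl; sym; trans; cong; subst; module ≡-Reasoning)
open import Relation.Nullary using (Dec; yes; no; contradiction)
import Data.Bool.Properties as Bool

∣p∣<n⇒∃∉ : ∀ {n} (p : Subset n) → ∣ p ∣ < n → ∃ λ i → i ∉ p
∣p∣<n⇒∃∉ (outside ∷ p) _       = zero , λ ()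
∣p∣<n⇒∃∉ (inside ∷ p)  (s≤s h) with ∣p∣<n⇒∃∉ p h
... | i , i∉p = suc i , λ i∈ → i∉p (drop-there i∈)

module _ {n t : ℕ} (t<n : t < n) (adv : MobileSendOmissionMAd n t) where
  open MobileSendOmissionMAd adv

  reliable-sender : ∀ ρ → ∃ λ k → ∀ j → delete ρ k j ≡ false
  reliable-sender ρ with ∣p∣<n⇒∃∉ (corrupted ρ) (<-≤-trans (s≤s (bound ρ)) t<n)
  ... | k , k∉ = k , λ j → Bool.¬-not (λ deleted → k∉ (deleteOK ρ k j deleted))

transmit : ∀ {A : Set} → Bool → A → Maybe A
transmit deleted x = if deleted then nothing else just x

transmit-false : ∀ {A : Set} {d} {x : A} → d ≡ false → transmit d x ≡ just x
transmit-false refl = refl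

transmit-just : ∀ {A : Set} d {x y : A} → transmit d x ≡ just y → x ≡ y
transmit-just false refl = refl

transmit-All : ∀ {A : Set} {P : A → Set} d {x} → P x → Maybe.All P (transmit d x)
transmit-All true  _  = nothing
transmit-All false px = just px

-- The outer nothing is a deleted message, the inner one the empty proposal.
Inbox : ℕ → Set
Inbox n = Fin n → Maybe (Maybe Bool)

Uncontested : ∀ {n} → Maybe Bool → Inbox n → Set
Uncontested m r = ∀ i → Maybe.All (_≡ m) (r i)

uncontested? : ∀ {n} m (r : Inbox n) → Dec (Uncontested m r)
uncontested? m r = all? λ i → Maybe.dec (λ x → ≡-dec Bool._≟_ x m) (r i)

uncontested-just : ∀ {n m} {r : Inbox n} → Uncontested m r → ∀ {i x} → r i ≡ just x → x ≡ m
uncontested-just {r = r} h {i} eq = drop-just (subst (Maybe.All _) eq (h i))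

propose : ∀ {n} → Bool → Inbox n → Maybe Bool
propose b r with uncontested? (just b) r
... | yes _ = just b
... | no  _ = nothing

propose-just : ∀ {n} b (r : Inbox n) {w} → propose b r ≡ just w → w ≡ b × Uncontested (just b) r
propose-just b r eq with uncontested? (just b) r
propose-just b r refl | yes u = refl , u
propose-just b r ()   | no  _

propose-uncontested : ∀ {n} b {r : Inbox n} → Uncontested (just b) r → propose b r ≡ just b
propose-uncontested b {r} u with uncontested? (just b) r
... | yes _ = refl
... | no ¬u = contradiction u ¬u

Proposes : Maybe (Maybe Bool) → Bool → Set
Proposes m w = m ≡ just (just w)

proposes? : ∀ m → Dec (∃ (Proposes m))
proposes? nothing         = no λ ()
proposes? (just nothing)  = no λ ()
proposes? (just (just w)) = yes (w , refl)

decide : ∀ {n} → Bool → Maybe Bool → Inbox n → Decision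
decide b (just w) r with uncontested? (just w) r
... | yes _ = commit w
... | no  _ = adopt w
decide b nothing r with any? (λ i → proposes? (r i))
... | yes (_ , w , _) = adopt w
... | no  _           = adopt b

decide-commit : ∀ {n} b p (r : Inbox n) {w} → decide b p r ≡ commit w → Uncontested (just w) r
decide-commit b (just v) r eq with uncontested? (just v) r
decide-commit b (just v) r refl | yes u = u
decide-commit b (just v) r ()   | no  _
decide-commit b nothing r eq with any? (λ i → proposes? (r i))
decide-commit b nothing r () | yes _
decide-commit b nothing r () | no  _

decide-uncontested : ∀ {n} b w {r : Inbox n} → Uncontested (just w) r → decide b (just w) r ≡ commit w
decide-uncontested b w {r} u with uncontested? (just w) r
... | yes _ = refl
... | no ¬u = contradiction u ¬u

decide-value : ∀ {n} b p (r : Inbox n) → (∀ {w} → p ≡ just w → w ≡ b) →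
               value (decide b p r) ≡ b ⊎ ∃ λ i → Proposes (r i) (value (decide b p r))
decide-value b (just w) r own with uncontested? (just w) r
... | yes _ = inj₁ (own refl)
... | no  _ = inj₁ (own refl)
decide-value b nothing r _ with any? (λ i → proposes? (r i))
... | yes (i , _ , eq) = inj₂ (i , eq)
... | no  _            = inj₁ refl

decide-agrees : ∀ {n} b p (r : Inbox n) {w} → (∀ {v} → p ≡ just v → v ≡ w) →
                (∀ i {v} → Proposes (r i) v → v ≡ w) → ∃ (λ k → Proposes (r k) w) →
                decide b p r ≡ commit w ⊎ decide b p r ≡ adopt w
decide-agrees b (just v) r own _ _ with own refl
... | refl with uncontested? (just v) r
...   | yes _ = inj₁ refl
...   | no  _ = inj₂ refl
decide-agrees b nothing r _ received (k , k-proposes) with any? (λ i → proposes? (r i))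
... | yes (i , _ , eq) = inj₂ (cong adopt (received i eq))
... | no  none         = contradiction (k , _ , k-proposes) none

record Local : Set where
  field
    input    : Bool
    proposal : Maybe Bool
    decided  : Decision

commitAdopt : (n : ℕ) → Protocol n
commitAdopt n = record
  { State  = Local
  ; Msg    = Maybe Bool
  ; rounds = 2
  ; init   = λ _ b → record { input = b ; proposal = nothing ; decided = adopt b }
  ; send   = λ { zero _ s _ → just (input s) ; (suc _) _ s _ → proposal s }
  ; step   = λ { zero    _ s r → record s { proposal = propose (input s) r }
               ; (suc _) _ s r → record s { decided = decide (input s) (proposal s) r } }
  ; output = λ _ s → decided s
  }
  where open Local

module Execution {n t : ℕ} (t<n : t < n) (adv : MobileSendOmissionMAd n t) (inp : Fin n → Bool) where
  open MobileSendOmissionMAd adv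

  inputs : Fin n → Inbox n
  inputs j i = transmit (delete 0 i j) (just (inp i))

  proposal : Fin n → Maybe Bool
  proposal j = propose (inp j) (inputs j)

  proposals : Fin n → Inbox n
  proposals j i = transmit (delete 1 i j) (proposal i)

  outcome : Fin n → Decision
  outcome j = decide (inp j) (proposal j) (proposals j)

  proposal-input : ∀ j {w} → proposal j ≡ just w → w ≡ inp j
  proposal-input j eq = proj₁ (propose-just (inp j) (inputs j) eq)

  proposal-reliable : ∀ {k} → (∀ j → delete 0 k j ≡ false) → ∀ j {w} → proposal j ≡ just w → w ≡ inp k
  proposal-reliable reliable j eq with propose-just (inp j) (inputs j) eq
  ... | refl , uncontested = sym (just-injective (uncontested-just uncontested (transmit-false (reliable j))))

  proposals-agree : ∀ i j {v w} → proposal i ≡ just v → proposal j ≡ just w → v ≡ w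
  proposals-agree i j pi pj with reliable-sender t<n adv 0
  ... | _ , reliable = trans (proposal-reliable reliable i pi) (sym (proposal-reliable reliable j pj))

  outcome-value : ∀ j → ∃ λ k → inp k ≡ value (outcome j)
  outcome-value j with decide-value (inp j) (proposal j) (proposals j) (proposal-input j)
  ... | inj₁ eq       = j , sym eq
  ... | inj₂ (i , eq) = i , sym (proposal-input i (transmit-just (delete 1 i j) eq))

  unanimous-commit : ∀ v → (∀ j → inp j ≡ v) → ∀ j → outcome j ≡ commit v
  unanimous-commit v same j = begin
    decide (inp j) (proposal j) (proposals j)     ≡⟨ cong (λ p → decide (inp j) p (proposals j)) (proposes-input j) ⟩
    decide (inp j) (just (inp j)) (proposals j)   ≡⟨ decide-uncontested (inp j) (inp j) uncontested ⟩
    commit (inp j)                                ≡⟨ cong commit (same j) ⟩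
    commit v                                      ∎
    where
    open ≡-Reasoning
    agree : ∀ i x → inp i ≡ inp x
    agree i x = trans (same i) (sym (same x))
    proposes-input : ∀ x → proposal x ≡ just (inp x)
    proposes-input x = propose-uncontested (inp x) λ i → transmit-All (delete 0 i x) (cong just (agree i x))
    uncontested : Uncontested (just (inp j)) (proposals j)
    uncontested i = transmit-All (delete 1 i j) (trans (proposes-input i) (cong just (agree i j)))

  commit-agreement : ∀ i v → outcome i ≡ commit v → ∀ j → outcome j ≡ commit v ⊎ outcome j ≡ adopt v
  commit-agreement i v committed j with reliable-sender t<n adv 1
  ... | k , reliable = decide-agrees (inp j) (proposal j) (proposals j)
                         (λ pj → proposals-agree j k pj k-proposes)
                         (λ x eq → proposals-agree x k (transmit-just (delete 1 x j) eq) k-proposes)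
                         (k , trans (transmit-false (reliable j)) (cong just k-proposes))
    where
    k-proposes : proposal k ≡ just v
    k-proposes = uncontested-just (decide-commit (inp i) (proposal i) (proposals i) committed)
                                  (transmit-false (reliable i))

theorem5p1 : (n t : ℕ) → t < n → Σ (Protocol n) (λ P → SolvesCommitAdopt P t)
theorem5p1 n t t<n = commitAdopt n , λ adv inp →
  let open Execution t<n adv inp in outcome-value , unanimous-commit , commit-agreement
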